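{- Let $p\ge 5$ be a prime and $s\ge 0$ an integer. Let $N$ be a graph containing vertices $x_0,x_1,\dots,x_{s+1}$ such that $N$ is the union of pieces $P_0,\dots,P_s$, where for each $0\le i\le s$ the piece $P_i$ is either the single edge $x_ix_{i+1}$ or a $p$-cycle through $x_i$ and $x_{i+1}$ consisting of a $k_i$-thread and a $(p-2-k_i)$-thread between $x_i$ and $x_{i+1}$ (for some $0\le k_i\le p-2$), and where distinct pieces share no vertices except that $P_{i-1}$ and $P_i$ share $x_i$. Fix a color $\omega(x_0)\in\{0,\dots,p-1\}$. For $0\le i\le s+1$ let $B(x_i)$ be the set of colors $c\in\{0,\dots,p-1\}$ such that there is a $C_p$-coloring of $P_0\cup\cdots\cup P_{i-1}$ assigning $\omega(x_0)$ to $x_0$ and $c$ to $x_i$ (so $B(x_0)=\{\omega(x_0)\}$). Then: (i) $|B(x_i)|\ge\min\{i+1,p\}$ for each $1\le i\le s+1$; (ii) if $s\ge p-2$, then for every assignment of colors from $\{0,\dots,p-1\}$ to $x_0$ and $x_{s+1}$ there is a $C_p$-coloring of $N$ extending it.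
   Context: A $C_p$-coloring of a graph $H$ is a map $\varphi:V(H)\to\{0,\dots,p-1\}$ with $\frac{p-1}{2}\le|\varphi(u)-\varphi(v)|\le\frac{p+1}{2}$ for every edge $uv$. An $m$-thread between $a$ and $b$ is a path from $a$ to $b$ with $m$ internal vertices. The graph $N$ is an $s$-necklace with end vertices $x_0,x_{s+1}$. -}

module Defs where

open import Data.Nat using (ℕ; zero; suc; _+_; _*_; _∸_; _≤_; _⊓_; ∣_-_∣)
open import Data.Nat.DivMod using (_/_)
open import Data.Fin using (Fin; toℕ; inject₁; fromℕ) renaming (zero to fzero; suc to fsuc)
open import Data.Bool using (Bool; true; false)
open import Data.List using (List; length; lookup; take)
open import Data.Product using (Σ; _×_)
open import Relation.Binary.PropositionalEquality using (_≡_)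
open import Function.Definitions using (Injective)

-- A graph: a vertex type and an (undirected-by-convention) edge relation.
record Graph : Set₁ where
  field
    V : Set
    E : V → V → Set
open Graph public

-- Admissible pair of colours for an edge in a C_p-colouring:
-- (p-1)/2 ≤ |a - b| ≤ (p+1)/2   (exact divisions, since p is odd here)
Adm : (p : ℕ) → Fin p → Fin p → Set
Adm p a b = ((p ∸ 1) / 2 ≤ ∣ toℕ a - toℕ b ∣) × (∣ toℕ a - toℕ b ∣ ≤ (p + 1) / 2)

CpColoring : (p : ℕ) → Graph → Set
CpColoring p H = Σ (V H → Fin p) λ φ → ∀ u v → E H u v → Adm p (φ u) (φ v)

-- A piece of the necklace between x_i and x_{i+1}:
-- either the single edge x_i x_{i+1}, or a p-cycle made of an a-thread
-- and a b-thread between x_i and x_{i+1} with a + b = p - 2.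
data Piece (p : ℕ) : Set where
  edge : Piece p
  cyc  : (a b : ℕ) → a + b + 2 ≡ p → Piece p

-- number of internal vertices of the thread on a given side of a piece
threadLen : {p : ℕ} → Piece p → Bool → ℕ
threadLen edge        _     = 0
threadLen (cyc a b _) false = a
threadLen (cyc a b _) true  = b

-- Vertices of the union of the pieces in the list ps:
-- hub j is x_j (0 ≤ j ≤ length ps); inner j side t is the t-th internal
-- vertex of the thread 'side' of piece j.
data NVert {p : ℕ} (ps : List (Piece p)) : Set where
  hub   : Fin (suc (length ps)) → NVert ps
  inner : (j : Fin (length ps)) (side : Bool) →
          Fin (threadLen (lookup ps j) side) → NVert ps

data NEdge {p : ℕ} (ps : List (Piece p)) : NVert ps → NVert ps → Set where
  single : (j : Fin (length ps)) → lookup ps j ≡ edge →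
           NEdge ps (hub (inject₁ j)) (hub (fsuc j))
  direct : (j : Fin (length ps)) (a b : ℕ) (e : a + b + 2 ≡ p) (side : Bool) →
           lookup ps j ≡ cyc a b e → threadLen (lookup ps j) side ≡ 0 →
           NEdge ps (hub (inject₁ j)) (hub (fsuc j))
  first  : (j : Fin (length ps)) (side : Bool) (t : Fin (threadLen (lookup ps j) side)) →
           toℕ t ≡ 0 → NEdge ps (hub (inject₁ j)) (inner j side t)
  step   : (j : Fin (length ps)) (side : Bool) (t t' : Fin (threadLen (lookup ps j) side)) →
           suc (toℕ t) ≡ toℕ t' → NEdge ps (inner j side t) (inner j side t')
  last   : (j : Fin (length ps)) (side : Bool) (t : Fin (threadLen (lookup ps j) side)) →
           suc (toℕ t) ≡ threadLen (lookup ps j) side →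
           NEdge ps (inner j side t) (hub (fsuc j))

Necklace : {p : ℕ} → List (Piece p) → Graph
Necklace ps = record { V = NVert ps ; E = NEdge ps }

x₀ : {p : ℕ} (ps : List (Piece p)) → NVert ps
x₀ ps = hub fzero

xEnd : {p : ℕ} (ps : List (Piece p)) → NVert ps
xEnd ps = hub (fromℕ (length ps))

InB : (p : ℕ) (ps : List (Piece p)) (i : ℕ) (ω₀ c : Fin p) → Set
InB p ps i ω₀ c =
  Σ (CpColoring p (Necklace (take i ps))) λ φ →
    (Σ.proj₁ φ (x₀ (take i ps)) ≡ ω₀) × (Σ.proj₁ φ (xEnd (take i ps)) ≡ c)

AtLeast : {p : ℕ} (m : ℕ) → (Fin p → Set) → Set
AtLeast {p} m P = Σ (Fin m → Fin p) λ f → Injective _≡_ _≡_ f × (∀ k → P (f k))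

-- With p = 2q + 1, stepping by q or q + 1 (mod p) is exactly what an edge of a C_p-colouring allows.
-- Colour each piece by choosing δ ∈ {q, q + 1}: walk its first thread in steps of δ and its second
-- thread in steps of p − δ; since the two threads together have p − 2 inner vertices, both walks
-- give x_{i+1} the same colour, that of x_i plus δ·D_i, where D_i − 1 is the length of the first
-- thread. Thus the colours reachable at x_i contain ω + q·ΣD + (all subset sums of D_0, …, D_{i−1}),
-- and since 0 < D_j < p, adding a summand {0, D_j} enlarges a proper subset of ℤ/p (p prime), which
-- gives at least min(i + 1, p) colours; when there are p of them, every colour is reachable.
module Submission where

open import Defs
open import Data.Nat
  using (ℕ; zero; suc; _+_; _*_; _∸_; _≤_; _<_; _⊓_; ∣_-_∣; z≤n; s≤s; _≟_; _<?_; _≤?_;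
         NonZero; >-nonZero; nonTrivial⇒n>1)
open import Data.Nat.Properties
open import Data.Nat.DivMod
open import Data.Nat.Divisibility using (m%n≡0⇒n∣m; n∣m⇒m%n≡0; ∣⇒≤)
open import Data.Nat.Primality using (Prime; euclidsLemma; prime⇒irreducible; prime⇒nonTrivial)
open import Data.Nat.Tactic.RingSolver using (solve-∀)
open import Data.Fin using (Fin; toℕ; inject₁; inject≤; punchOut) renaming (zero to fzero; suc to fsuc)
open import Data.Fin.Properties
  using (toℕ-fromℕ<; toℕ<n; toℕ-injective; toℕ-inject₁; toℕ-fromℕ; inject≤-injective; ¬Fin0; pigeonhole;
         all?; any?; ¬∀⟶∃¬; injective⇒≤; punchOut-injective)
  renaming (_≟_ to _≟ᶠ_)
open import Data.List using (List; []; _∷_; length; lookup; take)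
open import Data.List.Properties using (length-take)
open import Data.Bool using (Bool; true; false; not; _xor_)
open import Data.Product using (Σ; _×_; _,_; proj₁; proj₂; ∃-syntax)
open import Data.Sum using (_⊎_; inj₁; inj₂)
open import Data.Empty using (⊥-elim)
open import Relation.Nullary using (¬_; yes; no)
open import Relation.Binary.PropositionalEquality
  using (_≡_; _≢_; refl; sym; trans; cong; cong₂; subst; module ≡-Reasoning)
open import Relation.Binary.Bundles using (Setoid)
import Relation.Binary.Reasoning.Setoid as SetoidReasoning
open import Function using (_∘_)
open import Function.Definitions using (Injective)
open import Level using (0ℓ)

injective⇒surjective : ∀ {n} {f : Fin n → Fin n} → Injective _≡_ _≡_ f → ∀ c → ∃[ k ] f k ≡ c
injective⇒surjective {suc n} {f} f-inj c with any? (λ k → f k ≟ᶠ c)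
... | yes hit = hit
... | no miss = ⊥-elim (1+n≰n (injective⇒≤ squeeze-injective))
  where
  c≢f : ∀ k → c ≢ f k
  c≢f k c≡fk = miss (k , sym c≡fk)

  squeeze-injective : Injective _≡_ _≡_ (λ k → punchOut (c≢f k))
  squeeze-injective = f-inj ∘ punchOut-injective (c≢f _) (c≢f _)

AtLeast-≤ : ∀ {p m n} {P : Fin p → Set} → m ≤ n → AtLeast n P → AtLeast m P
AtLeast-≤ m≤n (f , f-inj , holds) =
  (λ k → f (inject≤ k m≤n)) , (λ e → inject≤-injective m≤n m≤n _ _ (f-inj e)) , (λ k → holds (inject≤ k m≤n))

AtLeast⇒all : ∀ {p} {P : Fin p → Set} → AtLeast p P → ∀ c → P c
AtLeast⇒all (f , f-inj , holds) c with injective⇒surjective f-inj c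
... | k , refl = holds k

Joins : (p : ℕ) (qs : List (Piece p)) (ω c : Fin p) → Set
Joins p qs ω c = Σ (CpColoring p (Necklace qs)) λ φ → (proj₁ φ (x₀ qs) ≡ ω) × (proj₁ φ (xEnd qs) ≡ c)

pieceAt : ∀ {p} → List (Piece p) → ℕ → Piece p
pieceAt []       _       = edge
pieceAt (pc ∷ _) zero    = pc
pieceAt (_ ∷ qs) (suc j) = pieceAt qs j

lookup≡pieceAt : ∀ {p} (qs : List (Piece p)) (j : Fin (length qs)) → lookup qs j ≡ pieceAt qs (toℕ j)
lookup≡pieceAt (_ ∷ _)  fzero    = refl
lookup≡pieceAt (_ ∷ qs) (fsuc j) = lookup≡pieceAt qs j

odd-prime : ∀ {p} → Prime p → 3 ≤ p → ∃[ q ] p ≡ suc (q + q)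
odd-prime {p} p-prime 3≤p with p % 2 in p%2 | m≡m%n+[m/n]*n p 2
... | zero | _ with prime⇒irreducible p-prime (m%n≡0⇒n∣m p 2 p%2)
...   | inj₁ ()
...   | inj₂ refl = ⊥-elim (<-irrefl refl 3≤p)
odd-prime {p} p-prime 3≤p | 1 | p≡1+[p/2]*2 = p / 2 , trans p≡1+[p/2]*2 (cong suc (double (p / 2)))
  where
  double : ∀ m → m * 2 ≡ m + m
  double = solve-∀
odd-prime {p} p-prime 3≤p | suc (suc r) | _ = ⊥-elim (<⇒≱ (m%n<n p 2) (subst (2 ≤_) (sym p%2) (s≤s (s≤s z≤n))))

_◂_ : Bool → (ℕ → Bool) → ℕ → Bool
(b ◂ σ) zero    = b
(b ◂ σ) (suc j) = σ j

-- Σ_{j<n} x j (σ j), unfolded from the front so that prepending a choice is definitional.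
choiceSum : (ℕ → Bool → ℕ) → (ℕ → Bool) → ℕ → ℕ
choiceSum x σ zero    = 0
choiceSum x σ (suc n) = x 0 (σ 0) + choiceSum (x ∘ suc) (σ ∘ suc) n

choiceSum-suc : ∀ x σ n → choiceSum x σ (suc n) ≡ choiceSum x σ n + x n (σ n)
choiceSum-suc x σ zero    = +-comm (x 0 (σ 0)) 0
choiceSum-suc x σ (suc n) = begin
  x 0 (σ 0) + choiceSum (x ∘ suc) (σ ∘ suc) (suc n)             ≡⟨ cong (x 0 (σ 0) +_) (choiceSum-suc (x ∘ suc) (σ ∘ suc) n) ⟩
  x 0 (σ 0) + (choiceSum (x ∘ suc) (σ ∘ suc) n + x (suc n) (σ (suc n))) ≡⟨ +-assoc (x 0 (σ 0)) _ _ ⟨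
  choiceSum x σ (suc n) + x (suc n) (σ (suc n))                 ∎
  where open ≡-Reasoning

∣m-[m+n]%o∣≡n⊎o∸n : ∀ {m n o} .{{_ : NonZero o}} → m < o → n ≤ o →
                     ∣ m - (m + n) % o ∣ ≡ n ⊎ ∣ m - (m + n) % o ∣ ≡ o ∸ n
∣m-[m+n]%o∣≡n⊎o∸n {m} {n} {o} m<o n≤o with m + n <? o
... | yes m+n<o = inj₁ (trans (cong (∣ m -_∣) (m<n⇒m%n≡m m+n<o)) (∣m-m+n∣≡n m n))
... | no m+n≮o = inj₂ (begin
  ∣ m - (m + n) % o ∣        ≡⟨ cong (∣ m -_∣) [m+n]%o≡r ⟩
  ∣ m - r ∣                  ≡⟨ cong (∣_- r ∣) r+[o∸n]≡m ⟨
  ∣ r + (o ∸ n) - r ∣        ≡⟨ ∣-∣-comm (r + (o ∸ n)) r ⟩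
  ∣ r - r + (o ∸ n) ∣        ≡⟨ ∣m-m+n∣≡n r (o ∸ n) ⟩
  o ∸ n                      ∎)
  where
  open ≡-Reasoning
  o≤m+n : o ≤ m + n
  o≤m+n = ≮⇒≥ m+n≮o

  r : ℕ
  r = m + n ∸ o

  r<o : r < o
  r<o = subst (r <_) (m+n∸m≡n o o) (∸-monoˡ-< (+-mono-<-≤ m<o n≤o) o≤m+n)

  [m+n]%o≡r : (m + n) % o ≡ r
  [m+n]%o≡r = trans (sym (m≤n⇒[n∸m]%m≡n%m o≤m+n)) (m<n⇒m%n≡m r<o)

  r+[o∸n]≡m : r + (o ∸ n) ≡ m
  r+[o∸n]≡m = +-cancelʳ-≡ n _ _ (begin
    r + (o ∸ n) + n  ≡⟨ +-assoc r (o ∸ n) n ⟩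
    r + (o ∸ n + n)  ≡⟨ cong (r +_) (m∸n+n≡m n≤o) ⟩
    r + o            ≡⟨ m∸n+n≡m o≤m+n ⟩
    m + n            ∎)

module Residues (p-1 : ℕ) where

  p : ℕ
  p = suc p-1

  infix 4 _≈_
  record _≈_ (x y : ℕ) : Set where
    constructor mod-≡
    field %-≡ : x % p ≡ y % p
  open _≈_ public

  ≈-setoid : Setoid 0ℓ 0ℓ
  ≈-setoid = record
    { _≈_           = _≈_
    ; isEquivalence = record
      { refl  = mod-≡ refl
      ; sym   = λ (mod-≡ e) → mod-≡ (sym e)
      ; trans = λ (mod-≡ e) (mod-≡ f) → mod-≡ (trans e f)
      }
    }

  open Setoid ≈-setoid public using () renaming (refl to ≈-refl; sym to ≈-sym; trans to ≈-trans)
  module ≈-Reasoning = SetoidReasoning ≈-setoid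

  ≡⇒≈ : ∀ {x y} → x ≡ y → x ≈ y
  ≡⇒≈ refl = ≈-refl

  +-multiple-≈ : ∀ x k → x + k * p ≈ x
  +-multiple-≈ x k = mod-≡ ([m+kn]%n≡m%n x k p)

  +-congʳ-≈ : ∀ {x y} z → x ≈ y → x + z ≈ y + z
  +-congʳ-≈ {x} {y} z (mod-≡ x≡y) = mod-≡ (begin
    (x + z) % p          ≡⟨ %-distribˡ-+ x z p ⟩
    (x % p + z % p) % p  ≡⟨ cong (λ r → (r + z % p) % p) x≡y ⟩
    (y % p + z % p) % p  ≡⟨ %-distribˡ-+ y z p ⟨
    (y + z) % p          ∎)
    where open ≡-Reasoning

  -- Adding z * p-1 completes + z to the multiple z * p.
  +-cancelʳ-≈ : ∀ {x y} z → x + z ≈ y + z → x ≈ y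
  +-cancelʳ-≈ {x} {y} z x+z≈y+z = begin
    x                  ≈⟨ +-multiple-≈ x z ⟨
    x + z * p          ≡⟨ complete x ⟩
    x + z + z * p-1    ≈⟨ +-congʳ-≈ (z * p-1) x+z≈y+z ⟩
    y + z + z * p-1    ≡⟨ complete y ⟨
    y + z * p          ≈⟨ +-multiple-≈ y z ⟩
    y                  ∎
    where
    open ≈-Reasoning
    complete : ∀ w → w + z * p ≡ w + z + z * p-1
    complete w = trans (cong (w +_) (*-suc z p-1)) (sym (+-assoc w z _))

  toℕ-mod : ∀ x → toℕ (x mod p) ≡ x % p
  toℕ-mod x = toℕ-fromℕ< (m%n<n x p)

  mod-≡⇒≈ : ∀ {x y} → x mod p ≡ y mod p → x ≈ y
  mod-≡⇒≈ {x} {y} e = mod-≡ (trans (sym (toℕ-mod x)) (trans (cong toℕ e) (toℕ-mod y)))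

  +-cancelˡ-≈ : ∀ {x y} z → z + x ≈ z + y → x ≈ y
  +-cancelˡ-≈ {x} {y} z z+x≈z+y = +-cancelʳ-≈ z (begin
    x + z  ≡⟨ +-comm x z ⟩
    z + x  ≈⟨ z+x≈z+y ⟩
    z + y  ≡⟨ +-comm z y ⟩
    y + z  ∎)
    where open ≈-Reasoning

module ChoiceSums (p-1 : ℕ) (p-prime : Prime (suc p-1)) where

  open Residues p-1

  *-≉0 : ∀ {r d} → 0 < r → r < p → ¬ d ≈ 0 → ¬ r * d ≈ 0
  *-≉0 {r} {d} 0<r r<p d≉0 (mod-≡ rd%p≡0) with euclidsLemma r d p-prime (m%n≡0⇒n∣m (r * d) p rd%p≡0)
  ... | inj₁ p∣r = <⇒≱ r<p (∣⇒≤ {{>-nonZero 0<r}} p∣r)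
  ... | inj₂ p∣d = d≉0 (mod-≡ (n∣m⇒m%n≡0 d p p∣d))

  module _ {m d} (xs : Fin (suc m) → ℕ) (π : Fin (suc m) → Fin (suc m)) (closed : ∀ k → xs k + d ≈ xs (π k)) where

    orbit : ℕ → Fin (suc m)
    orbit zero    = fzero
    orbit (suc t) = π (orbit t)

    orbit-value : ∀ t → xs fzero + t * d ≈ xs (orbit t)
    orbit-value zero    = ≡⇒≈ (+-identityʳ (xs fzero))
    orbit-value (suc t) = begin
      xs fzero + (d + t * d)  ≡⟨ cong (xs fzero +_) (+-comm d (t * d)) ⟩
      xs fzero + (t * d + d)  ≡⟨ +-assoc (xs fzero) (t * d) d ⟨
      xs fzero + t * d + d    ≈⟨ +-congʳ-≈ d (orbit-value t) ⟩
      xs (orbit t) + d        ≈⟨ closed (orbit t) ⟩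
      xs (orbit (suc t))      ∎
      where open ≈-Reasoning

    orbit-period : ∀ {i j} → i ≤ j → orbit i ≡ orbit j → (j ∸ i) * d ≈ 0
    orbit-period {i} {j} i≤j same-point = +-cancelˡ-≈ (xs fzero + i * d) (begin
      xs fzero + i * d + (j ∸ i) * d  ≡⟨ +-assoc (xs fzero) _ _ ⟩
      xs fzero + (i * d + (j ∸ i) * d) ≡⟨ cong (xs fzero +_) (*-distribʳ-+ d i (j ∸ i)) ⟨
      xs fzero + (i + (j ∸ i)) * d    ≡⟨ cong (λ k → xs fzero + k * d) (m+[n∸m]≡n i≤j) ⟩
      xs fzero + j * d                ≈⟨ orbit-value j ⟩
      xs (orbit j)                    ≡⟨ cong xs same-point ⟨
      xs (orbit i)                    ≈⟨ orbit-value i ⟨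
      xs fzero + i * d                ≡⟨ +-identityʳ _ ⟨
      xs fzero + i * d + 0            ∎)
      where open ≈-Reasoning

    -- p steps of the orbit are pairwise distinct, so xs takes at least p values.
    shift-closed⇒p≤ : ¬ d ≈ 0 → p ≤ suc m
    shift-closed⇒p≤ d≉0 with p ≤? suc m
    ... | yes p≤m+1 = p≤m+1
    ... | no p≰m+1 with pigeonhole (≰⇒> p≰m+1) (orbit ∘ toℕ)
    ...   | i , j , i<j , same-point = ⊥-elim (*-≉0 (m<n⇒0<n∸m i<j) (≤-<-trans (m∸n≤m (toℕ j) (toℕ i)) (toℕ<n j)) d≉0
              (orbit-period (<⇒≤ i<j) same-point))

  shift-escapes : ∀ {m d} → suc m < p → ¬ d ≈ 0 → (xs : Fin (suc m) → ℕ) → ∃[ k ] ∀ j → ¬ xs k + d ≈ xs j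
  shift-escapes {m} {d} m+1<p d≉0 xs with all? (λ k → any? (λ j → (xs k + d) % p ≟ xs j % p))
  ... | yes closed = ⊥-elim (<⇒≱ m+1<p (shift-closed⇒p≤ xs (proj₁ ∘ closed) (mod-≡ ∘ proj₂ ∘ closed) d≉0))
  ... | no not-closed with ¬∀⟶∃¬ _ _ (λ k → any? (λ j → (xs k + d) % p ≟ xs j % p)) not-closed
  ...   | k , escapes = k , λ j (mod-≡ e) → escapes (j , e)

  record Distinct (x : ℕ → Bool → ℕ) (n m : ℕ) : Set where
    constructor distinct
    field
      choices        : Fin m → ℕ → Bool
      sums-injective : Injective _≡_ _≈_ (λ k → choiceSum x (choices k) n)

  Distinct-≤ : ∀ {x n m m′} → m′ ≤ m → Distinct x n m → Distinct x n m′
  Distinct-≤ m′≤m (distinct σ σ-inj) = distinct (λ k → σ (inject≤ k m′≤m)) (λ e → inject≤-injective m′≤m m′≤m _ _ (σ-inj e))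

  Distinct-extend : ∀ {x n m} → Distinct (x ∘ suc) n m → Distinct x (suc n) m
  Distinct-extend {x} (distinct σ σ-inj) = distinct (λ k → false ◂ σ k) (σ-inj ∘ +-cancelˡ-≈ (x 0 false))

  Distinct-grow : ∀ {x n m d} → x 0 true ≡ d + x 0 false → ¬ d ≈ 0 → suc m < p →
                  Distinct (x ∘ suc) n (suc m) → Distinct x (suc n) (suc (suc m))
  Distinct-grow {x} {n} {m} {d} gap d≉0 m+1<p (distinct σ σ-inj) = distinct τ τ-inj
    where
    v : Fin (suc m) → ℕ
    v k = choiceSum (x ∘ suc) (σ k) n

    escape : ∃[ k ] ∀ j → ¬ v k + d ≈ v j
    escape = shift-escapes m+1<p d≉0 v

    k₀ : Fin (suc m)
    k₀ = proj₁ escape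

    τ : Fin (suc (suc m)) → ℕ → Bool
    τ fzero    = true ◂ σ k₀
    τ (fsuc k) = false ◂ σ k

    fresh : ∀ j → ¬ x 0 true + v k₀ ≈ x 0 false + v j
    fresh j e = proj₂ escape j (+-cancelˡ-≈ (x 0 false) (begin
      x 0 false + (v k₀ + d)  ≡⟨ shuffle (x 0 false) (v k₀) d ⟩
      d + x 0 false + v k₀    ≡⟨ cong (_+ v k₀) gap ⟨
      x 0 true + v k₀         ≈⟨ e ⟩
      x 0 false + v j         ∎))
      where
      open ≈-Reasoning
      shuffle : ∀ a b c → a + (b + c) ≡ c + a + b
      shuffle = solve-∀

    τ-inj : Injective _≡_ _≈_ (λ k → choiceSum x (τ k) (suc n))
    τ-inj {fzero}  {fzero}  _ = refl
    τ-inj {fzero}  {fsuc j} e = ⊥-elim (fresh j e)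
    τ-inj {fsuc k} {fzero}  e = ⊥-elim (fresh k (≈-sym e))
    τ-inj {fsuc k} {fsuc j} e = cong fsuc (σ-inj (+-cancelˡ-≈ (x 0 false) e))

  -- Cauchy–Davenport for two-element summands.
  choiceSums-distinct : ∀ x d → (∀ j → x j true ≡ d j + x j false) → (∀ j → ¬ d j ≈ 0) →
                        ∀ n → Distinct x n (suc n ⊓ p)
  choiceSums-distinct x d gap d≉0 zero = distinct (λ _ _ → false) λ { {fzero} {fzero} _ → refl }
  choiceSums-distinct x d gap d≉0 (suc n)
    with suc n <? p | choiceSums-distinct (x ∘ suc) (d ∘ suc) (gap ∘ suc) (d≉0 ∘ suc) n
  ... | yes n+1<p | rest =
    Distinct-≤ (m⊓n≤m _ p) (Distinct-grow (gap 0) (d≉0 0) n+1<p (Distinct-≤ (⊓-glb ≤-refl (<⇒≤ n+1<p)) rest))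
  ... | no n+1≮p | rest =
    Distinct-extend (Distinct-≤ (≤-trans (m⊓n≤n _ p) (⊓-glb (≮⇒≥ n+1≮p) ≤-refl)) rest)

module NecklaceColouring (q : ℕ) (p-prime : Prime (suc (q + q))) where

  open Residues (q + q)
  open ChoiceSums (q + q) p-prime

  δ : Bool → ℕ
  δ false = q
  δ true  = suc q

  δ+δ∘not : ∀ b → δ b + δ (not b) ≡ p
  δ+δ∘not false = +-suc q q
  δ+δ∘not true  = refl

  half-below : (p ∸ 1) / 2 ≡ q
  half-below = trans (cong (_/ 2) (double q)) (m*n/n≡m q 2)
    where
    double : ∀ m → m + m ≡ m * 2
    double = solve-∀

  half-above : (p + 1) / 2 ≡ suc q
  half-above = trans (cong (_/ 2) (double q)) (m*n/n≡m (suc q) 2)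
    where
    double : ∀ m → suc (m + m) + 1 ≡ suc m * 2
    double = solve-∀

  Admissible : ℕ → Set
  Admissible k = (p ∸ 1) / 2 ≤ k × k ≤ (p + 1) / 2

  δ-admissible : ∀ b → Admissible (δ b)
  δ-admissible false = ≤-reflexive half-below , ≤-trans (n≤1+n q) (≤-reflexive (sym half-above))
  δ-admissible true  = ≤-trans (≤-reflexive half-below) (n≤1+n q) , ≤-reflexive (sym half-above)

  p∸δ≡δ∘not : ∀ b → p ∸ δ b ≡ δ (not b)
  p∸δ≡δ∘not b = trans (cong (_∸ δ b) (sym (δ+δ∘not b))) (m+n∸m≡n (δ b) _)

  δ-or-complement-admissible : ∀ b {k} → k ≡ δ b ⊎ k ≡ p ∸ δ b → Admissible k
  δ-or-complement-admissible b (inj₁ refl) = δ-admissible b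
  δ-or-complement-admissible b (inj₂ refl) = subst Admissible (sym (p∸δ≡δ∘not b)) (δ-admissible (not b))

  adm-step : ∀ b {u v} → v ≈ u + δ b → Adm p (u mod p) (v mod p)
  adm-step b {u} {v} (mod-≡ v≡u+δ) = subst Admissible (sym distance)
    (δ-or-complement-admissible b (∣m-[m+n]%o∣≡n⊎o∸n (m%n<n u p) (subst (δ b ≤_) (δ+δ∘not b) (m≤m+n (δ b) _))))
    where
    distance : ∣ toℕ (u mod p) - toℕ (v mod p) ∣ ≡ ∣ u % p - (u % p + δ b) % p ∣
    distance = cong₂ ∣_-_∣ (toℕ-mod u) (trans (toℕ-mod v) (trans v≡u+δ (sym (%-≡ (+-congʳ-≈ {u % p} {u} (δ b) (mod-≡ (m%n%n≡m%n u p)))))))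

  -- Adding δ b * suc c to both sides gives δ b * p and suc c * p respectively, both ≈ 0.
  cycle-closes : ∀ W b {a c} → a + c + 2 ≡ p → W + δ b * suc a ≈ W + δ (not b) * suc c
  cycle-closes W b {a} {c} a+c+2≡p = +-cancelʳ-≈ (s * suc c) (begin
    W + s * suc a + s * suc c  ≡⟨ collect-s W s a c ⟩
    W + s * (a + c + 2)        ≡⟨ cong (λ k → W + s * k) a+c+2≡p ⟩
    W + s * p                  ≈⟨ +-multiple-≈ W s ⟩
    W                          ≈⟨ +-multiple-≈ W (suc c) ⟨
    W + suc c * p              ≡⟨ cong (λ k → W + suc c * k) (δ+δ∘not b) ⟨
    W + suc c * (s + t)        ≡⟨ collect-c W s t c ⟩
    W + t * suc c + s * suc c  ∎)
    where
    open ≈-Reasoning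
    s t : ℕ
    s = δ b
    t = δ (not b)
    collect-s : ∀ W s a c → W + s * suc a + s * suc c ≡ W + s * (a + c + 2)
    collect-s = solve-∀
    collect-c : ∀ W s t c → W + suc c * (s + t) ≡ W + t * suc c + s * suc c
    collect-c = solve-∀

  piece-closes : ∀ pc → pc ≢ edge → ∀ b side W →
                 W + δ b * suc (threadLen pc false) ≈ W + δ (side xor b) * suc (threadLen pc side)
  piece-closes edge        pc≢edge _ _     _ = ⊥-elim (pc≢edge refl)
  piece-closes (cyc _ _ _) _       _ false _ = ≈-refl
  piece-closes (cyc _ _ e) _       b true  W = cycle-closes W b e

  arm<p : ∀ (pc : Piece p) → suc (threadLen pc false) < p
  arm<p edge        = nonTrivial⇒n>1 p {{prime⇒nonTrivial p-prime}}
  arm<p (cyc a c e) = subst (suc (suc a) ≤_) (trans (+-comm 2 (a + c)) e) (s≤s (s≤s (m≤m+n a c)))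

  arm≉0 : ∀ (pc : Piece p) → ¬ suc (threadLen pc false) ≈ 0
  arm≉0 pc (mod-≡ arm%p≡0) with trans (sym (m<n⇒m%n≡m (arm<p pc))) arm%p≡0
  ... | ()

  module _ (qs : List (Piece p)) where

    arm : ℕ → ℕ
    arm j = suc (threadLen (pieceAt qs j) false)

    hop : ℕ → Bool → ℕ
    hop j b = δ b * arm j

    module _ (ω : Fin p) (σ : ℕ → Bool) where

      hubValue : ℕ → ℕ
      hubValue i = toℕ ω + choiceSum hop σ i

      along : Fin (length qs) → Bool → ℕ → ℕ
      along j side k = hubValue (toℕ j) + δ (side xor σ (toℕ j)) * k

      value : NVert qs → ℕ
      value (hub i)          = hubValue (toℕ i)
      value (inner j side t) = along j side (suc (toℕ t))

      along-suc : ∀ j side k → along j side (suc k) ≡ along j side k + δ (side xor σ (toℕ j))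
      along-suc j side k = regroup (hubValue (toℕ j)) (δ (side xor σ (toℕ j))) k
        where
        regroup : ∀ W s k → W + s * suc k ≡ W + s * k + s
        regroup = solve-∀

      leaves-hub : ∀ j side → along j side 1 ≡ value (hub (inject₁ j)) + δ (side xor σ (toℕ j))
      leaves-hub j side = cong₂ _+_ (cong hubValue (sym (toℕ-inject₁ j))) (*-identityʳ _)

      hub-suc : ∀ j → value (hub (fsuc j)) ≡ along j false (suc (threadLen (lookup qs j) false))
      hub-suc j = begin
        toℕ ω + choiceSum hop σ (suc (toℕ j))                      ≡⟨ cong (toℕ ω +_) (choiceSum-suc hop σ (toℕ j)) ⟩
        toℕ ω + (choiceSum hop σ (toℕ j) + hop (toℕ j) (σ (toℕ j))) ≡⟨ +-assoc (toℕ ω) _ _ ⟨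
        hubValue (toℕ j) + δ (σ (toℕ j)) * arm (toℕ j)              ≡⟨ cong (λ pc → hubValue (toℕ j) + δ (σ (toℕ j)) * suc (threadLen pc false)) (lookup≡pieceAt qs j) ⟨
        along j false (suc (threadLen (lookup qs j) false))         ∎
        where open ≡-Reasoning

      hub-arrives : ∀ j side → lookup qs j ≢ edge → value (hub (fsuc j)) ≈ along j side (suc (threadLen (lookup qs j) side))
      hub-arrives j side not-edge = ≈-trans (≡⇒≈ (hub-suc j)) (piece-closes (lookup qs j) not-edge (σ (toℕ j)) side (hubValue (toℕ j)))

      edge-step : ∀ {u v} → NEdge qs u v → ∃[ b ] value v ≈ value u + δ b
      edge-step (single j is-edge) = σ (toℕ j) , ≡⇒≈ (begin
        value (hub (fsuc j))                                  ≡⟨ hub-suc j ⟩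
        along j false (suc (threadLen (lookup qs j) false))   ≡⟨ cong (λ pc → along j false (suc (threadLen pc false))) is-edge ⟩
        along j false 1                                       ≡⟨ leaves-hub j false ⟩
        value (hub (inject₁ j)) + δ (σ (toℕ j))               ∎)
        where open ≡-Reasoning
      edge-step (direct j a c e side is-cyc no-inner) = side xor σ (toℕ j) , (begin
        value (hub (fsuc j))                                  ≈⟨ hub-arrives j side (λ is-edge → cyc≢edge (trans (sym is-cyc) is-edge)) ⟩
        along j side (suc (threadLen (lookup qs j) side))     ≡⟨ cong (along j side ∘ suc) no-inner ⟩
        along j side 1                                        ≡⟨ leaves-hub j side ⟩
        value (hub (inject₁ j)) + δ (side xor σ (toℕ j))      ∎)
        where
        open ≈-Reasoning
        cyc≢edge : cyc a c e ≢ edge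
        cyc≢edge ()
      edge-step (first j side t t≡0) = side xor σ (toℕ j) , ≡⇒≈ (trans (cong (along j side ∘ suc) t≡0) (leaves-hub j side))
      edge-step (step j side t t′ t+1≡t′) = side xor σ (toℕ j) , ≡⇒≈ (trans (cong (along j side ∘ suc) (sym t+1≡t′)) (along-suc j side (suc (toℕ t))))
      edge-step (last j side t t+1≡len) = side xor σ (toℕ j) , (begin
        value (hub (fsuc j))                                  ≈⟨ hub-arrives j side (λ is-edge → ¬Fin0 (subst (λ pc → Fin (threadLen pc side)) is-edge t)) ⟩
        along j side (suc (threadLen (lookup qs j) side))     ≡⟨ cong (along j side ∘ suc) t+1≡len ⟨
        along j side (suc (suc (toℕ t)))                      ≡⟨ along-suc j side (suc (toℕ t)) ⟩
        value (inner j side t) + δ (side xor σ (toℕ j))       ∎)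
        where open ≈-Reasoning

      colouring : CpColoring p (Necklace qs)
      colouring = (λ v → value v mod p) , λ _ _ uv → adm-step (proj₁ (edge-step uv)) (proj₂ (edge-step uv))

      colouring-x₀ : proj₁ colouring (x₀ qs) ≡ ω
      colouring-x₀ = toℕ-injective (begin
        toℕ ((toℕ ω + 0) mod p)  ≡⟨ toℕ-mod (toℕ ω + 0) ⟩
        (toℕ ω + 0) % p          ≡⟨ cong (_% p) (+-identityʳ (toℕ ω)) ⟩
        toℕ ω % p                ≡⟨ m<n⇒m%n≡m (toℕ<n ω) ⟩
        toℕ ω                    ∎)
        where open ≡-Reasoning

      colouring-xEnd : proj₁ colouring (xEnd qs) ≡ hubValue (length qs) mod p
      colouring-xEnd = cong (λ i → hubValue i mod p) (toℕ-fromℕ (length qs))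

    necklace-ends : ∀ ω → AtLeast (suc (length qs) ⊓ p) (Joins p qs ω)
    necklace-ends ω with choiceSums-distinct hop arm (λ _ → refl) (arm≉0 ∘ pieceAt qs) (length qs)
    ... | distinct σ σ-inj =
      (λ k → hubValue ω (σ k) (length qs) mod p) ,
      (λ e → σ-inj (+-cancelˡ-≈ (toℕ ω) (mod-≡⇒≈ e))) ,
      (λ k → colouring ω (σ k) , colouring-x₀ ω (σ k) , colouring-xEnd ω (σ k))

lemma3p2 : (p : ℕ) → Prime p → 5 ≤ p → (s : ℕ) → (ps : List (Piece p)) → length ps ≡ suc s →
    ((ω₀ : Fin p) → (i : ℕ) → 1 ≤ i → i ≤ suc s → AtLeast ((i + 1) ⊓ p) (InB p ps i ω₀))
    × (p ∸ 2 ≤ s → (c d : Fin p) →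
        Σ (CpColoring p (Necklace ps)) λ φ → (proj₁ φ (x₀ ps) ≡ c) × (proj₁ φ (xEnd ps) ≡ d))
lemma3p2 p p-prime 5≤p s ps length≡s+1 with odd-prime p-prime (≤-trans (s≤s (s≤s (s≤s z≤n))) 5≤p)
... | q , refl = prefix-colours , all-ends
  where
  open NecklaceColouring q p-prime

  prefix-colours : ∀ ω₀ i → 1 ≤ i → i ≤ suc s → AtLeast ((i + 1) ⊓ p) (InB p ps i ω₀)
  prefix-colours ω₀ i _ i≤s+1 = AtLeast-≤ {P = InB p ps i ω₀} (≤-reflexive (cong (_⊓ p) (begin
    i + 1                        ≡⟨ +-comm i 1 ⟩
    suc i                        ≡⟨ cong suc (m≤n⇒m⊓n≡m i≤s+1) ⟨
    suc (i ⊓ suc s)              ≡⟨ cong (λ n → suc (i ⊓ n)) length≡s+1 ⟨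
    suc (i ⊓ length ps)          ≡⟨ cong suc (length-take i ps) ⟨
    suc (length (take i ps))     ∎)))
    (necklace-ends (take i ps) ω₀)
    where open ≡-Reasoning

  all-ends : p ∸ 2 ≤ s → ∀ c d → Joins p ps c d
  all-ends p∸2≤s c = AtLeast⇒all (AtLeast-≤ {P = Joins p ps c} (⊓-glb p≤length+1 ≤-refl) (necklace-ends ps c))
    where
    p≤length+1 : p ≤ suc (length ps)
    p≤length+1 = subst (λ n → p ≤ suc n) (sym length≡s+1) (s≤s (≤-trans (m≤n+m∸n (q + q) 1) (+-monoʳ-≤ 1 p∸2≤s)))
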